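{- In Gödel's sequent system $\mathcal{G}$, the cut rule is derivable: for all formulas $P,Q$ and finite sequences of formulas $\Delta,\Gamma$, if $\Gamma\rightarrow P$ and $\Delta,P\rightarrow Q$ are provable in $\mathcal{G}$, then $\Delta,\Gamma\rightarrow Q$ is provable in $\mathcal{G}$.
   Context: Formulas are built from propositional letters with the connectives $\sim$ (negation) and $\supset$ (implication). A sequent has the form $\Delta\rightarrow P$, where $\Delta$ is a finite, possibly empty, sequence of formulas and $P$ is a formula. Gödel's system $\mathcal{G}$ has as axioms all sequents $P\rightarrow P$, and the rules: thinning: from $\Delta\rightarrow Q$ infer $P,\Delta\rightarrow Q$, and from $\Delta\rightarrow Q$ infer $\Delta,P\rightarrow Q$; implication introduction: from $\Delta,P\rightarrow Q$ infer $\Delta\rightarrow P\supset Q$; implication elimination: from $\Delta\rightarrow P$ and $\Delta\rightarrow P\supset Q$ infer $\Delta\rightarrow Q$; reductio ad absurdum: from $\Delta,\sim P\rightarrow Q$ and $\Delta,\sim P\rightarrow\,\sim Q$ infer $\Delta\rightarrow P$. A sequent is provable if it is obtained from axioms by finitely many rule applications. -}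

module Defs where

open import Data.Nat using (ℕ)
open import Data.List using (List; []; _∷_; _++_; [_])

data Formula : Set where
  var  : ℕ → Formula
  ~_   : Formula → Formula
  _⊃_  : Formula → Formula → Formula

infix  30 ~_
infixr 20 _⊃_

-- Sequent Δ → P, with Δ a finite sequence (list) of formulas.
-- Provability in Gödel's system 𝒢.  "Δ , P" is Δ ++ [ P ].
infix 5 ⊢_⇒_
data ⊢_⇒_ : List Formula → Formula → Set where
  ax     : ∀ {P} → ⊢ [ P ] ⇒ P
  thinL  : ∀ {Δ P Q} → ⊢ Δ ⇒ Q → ⊢ P ∷ Δ ⇒ Q
  thinR  : ∀ {Δ P Q} → ⊢ Δ ⇒ Q → ⊢ Δ ++ [ P ] ⇒ Q
  ⊃I     : ∀ {Δ P Q} → ⊢ Δ ++ [ P ] ⇒ Q → ⊢ Δ ⇒ P ⊃ Q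
  ⊃E     : ∀ {Δ P Q} → ⊢ Δ ⇒ P → ⊢ Δ ⇒ P ⊃ Q → ⊢ Δ ⇒ Q
  raa    : ∀ {Δ P Q} → ⊢ Δ ++ [ ~ P ] ⇒ Q → ⊢ Δ ++ [ ~ P ] ⇒ ~ Q → ⊢ Δ ⇒ P

module Submission where

open import Defs
open import Data.List using (List; []; _∷_; _++_; [_])
open import Data.List.Properties using (++-assoc; ++-identityʳ)
open import Relation.Binary.PropositionalEquality using (subst; sym)

-- Cut is implication elimination after weakening both premises to the
-- common context Δ , Γ, the second one having first been turned into Δ → P ⊃ Q.

weakenˡ : ∀ {Γ P} (Δ : List Formula) → ⊢ Γ ⇒ P → ⊢ Δ ++ Γ ⇒ P
weakenˡ []      d = d
weakenˡ (_ ∷ Δ) d = thinL (weakenˡ Δ d)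

weakenʳ : ∀ {Δ P} (Γ : List Formula) → ⊢ Δ ⇒ P → ⊢ Δ ++ Γ ⇒ P
weakenʳ {Δ} {P} []      d = subst (λ Θ → ⊢ Θ ⇒ P) (sym (++-identityʳ Δ)) d
weakenʳ {Δ} {P} (G ∷ Γ) d = subst (λ Θ → ⊢ Θ ⇒ P) (++-assoc Δ [ G ] Γ) (weakenʳ Γ (thinR d))

mainTheorem3 : ∀ (P Q : Formula) (Δ Γ : List Formula) → ⊢ Γ ⇒ P → ⊢ Δ ++ [ P ] ⇒ Q → ⊢ Δ ++ Γ ⇒ Q
mainTheorem3 P Q Δ Γ ⊢P ⊢Q = ⊃E (weakenˡ Δ ⊢P) (weakenʳ Γ (⊃I ⊢Q))
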